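{- Let $M,N\in\Lambda^{001}_\infty$. If for every $d\in\mathbf N$ there exists a $d$-positive resource term $s_d\in\mathcal T(M)\cap\mathcal T(N)$, then $M=N$.
   Context: Fix an infinite set $\mathcal V$ of variables. $\Lambda^{001}_\infty=\nu Y.\mu X.(\mathcal V+\lambda\mathcal V.X+(X)Y)$ is the set of possibly infinite syntax trees built from variables, abstractions $\lambda x.M$ and applications $(M)N$, in which every infinite branch passes infinitely often through the argument (right) subterm of an application; terms are up to α-equivalence. Resource terms: $s::=x\mid\lambda x.s\mid\langle s\rangle\bar t$ with $\bar t$ a finite multiset of resource terms. Taylor approximation: $x\ltimes x$; $\lambda x.s\ltimes\lambda x.M$ if $s\ltimes M$; $\langle s\rangle[t_1,\dots,t_n]\ltimes(M)N$ if $s\ltimes M$ and all $t_i\ltimes N$ (inductive, $n\ge0$); $\mathcal T(M)=\{s\mid s\ltimes M\}$. $d$-positive resource terms: every resource term is $0$-positive; for $d\ge1$ the $d$-positive terms are generated inductively by $x$, $\lambda x.s$ with $s$ $d$-positive, and $\langle s\rangle\bar t$ with $s$ $d$-positive and $\bar t$ a non-empty finite multiset of $(d-1)$-positive terms. -}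

module Defs where

open import Data.Nat using (ℕ; zero; suc)
open import Data.List using (List; []; _∷_)
open import Data.List.Relation.Unary.All using (All)
open import Data.Product using (Σ; _×_)

-- Variables are de Bruijn indices (ℕ: infinitely many, free variables
-- allowed), so α-equivalent terms are syntactically identical.

data Shape (Y : Set) : Set where
  var : ℕ → Shape Y
  lam : Shape Y → Shape Y
  app : Shape Y → Y → Shape Y

record Tm : Set₁ where
  field
    St     : Set
    unfold : St → Shape St
    root   : St
open Tm public

data ShapeRel {Y₁ Y₂ : Set} (R : Y₁ → Y₂ → Set) : Shape Y₁ → Shape Y₂ → Set where
  var : ∀ x → ShapeRel R (var x) (var x)
  lam : ∀ {a b} → ShapeRel R a b → ShapeRel R (lam a) (lam b)
  app : ∀ {a b p q} → ShapeRel R a b → R p q → ShapeRel R (app a p) (app b q)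

IsBisimulation : (M N : Tm) → (St M → St N → Set) → Set
IsBisimulation M N R = ∀ p q → R p q → ShapeRel R (unfold M p) (unfold N q)

_≈_ : Tm → Tm → Set₁
M ≈ N = Σ (St M → St N → Set) (λ R → IsBisimulation M N R × R (root M) (root N))

-- Resource terms; the finite multiset of arguments is represented by a
-- list (every notion below is invariant under permuting that list).
data RTm : Set where
  var : ℕ → RTm
  lam : RTm → RTm
  app : RTm → List RTm → RTm

module Approx {Y : Set} (unf : Y → Shape Y) where
  data _⋉_ : RTm → Shape Y → Set where
    var : ∀ x → var x ⋉ var x
    lam : ∀ {s a} → s ⋉ a → lam s ⋉ lam a
    app : ∀ {s ts a p} → s ⋉ a → All (λ t → t ⋉ unf p) ts → app s ts ⋉ app a p

𝒯 : Tm → RTm → Set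
𝒯 M s = Approx._⋉_ (unfold M) s (unfold M (root M))

data Positive : ℕ → RTm → Set where
  zero : ∀ s → Positive 0 s
  var  : ∀ {d} x → Positive (suc d) (var x)
  lam  : ∀ {d s} → Positive (suc d) s → Positive (suc d) (lam s)
  app  : ∀ {d s t ts} → Positive (suc d) s → All (Positive d) (t ∷ ts)
       → Positive (suc d) (app s (t ∷ ts))

{-# OPTIONS --safe #-}
-- Any common approximant already forces the
-- two shapes to agree in their outermost constructor, and a (d+1)-positive
-- approximant of an application has a non-empty argument bag whose elements
-- are d-positive common approximants of the two arguments. So joint
-- approximability of the unfoldings of states is a bisimulation.
module Submission where

open import Defs
open import Data.Nat using (ℕ; zero; suc)
open import Data.Product using (Σ; _×_; _,_)
open import Data.List using (_∷_)
open import Data.List.Relation.Unary.All using (_∷_)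

positive-lam⁻¹ : ∀ d {s} → Positive d (lam s) → Positive d s
positive-lam⁻¹ zero    _       = zero _
positive-lam⁻¹ (suc d) (lam p) = p

positive-app⁻¹ : ∀ d {s ts} → Positive d (app s ts) → Positive d s
positive-app⁻¹ zero    _         = zero _
positive-app⁻¹ (suc d) (app p _) = p

module JointApproximation {Y₁ Y₂ : Set} (unf₁ : Y₁ → Shape Y₁) (unf₂ : Y₂ → Shape Y₂) where
  open Approx unf₁ renaming (_⋉_ to _⋉₁_)
  open Approx unf₂ renaming (_⋉_ to _⋉₂_)

  JointlyApproximable : Shape Y₁ → Shape Y₂ → Set
  JointlyApproximable a b = (d : ℕ) → Σ RTm (λ s → Positive d s × s ⋉₁ a × s ⋉₂ b)

  JointlyApproximableSt : Y₁ → Y₂ → Set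
  JointlyApproximableSt p q = JointlyApproximable (unf₁ p) (unf₂ q)

  jointly-lam⁻¹ : ∀ {a b} → JointlyApproximable (lam a) (lam b) → JointlyApproximable a b
  jointly-lam⁻¹ h d with h d
  ... | lam s , pos , lam s⋉a , lam s⋉b = s , positive-lam⁻¹ d pos , s⋉a , s⋉b

  jointly-appˡ⁻¹ : ∀ {a b p q} → JointlyApproximable (app a p) (app b q) → JointlyApproximable a b
  jointly-appˡ⁻¹ h d with h d
  ... | app s _ , pos , app s⋉a _ , app s⋉b _ = s , positive-app⁻¹ d pos , s⋉a , s⋉b

  jointly-appʳ⁻¹ : ∀ {a b p q} → JointlyApproximable (app a p) (app b q) → JointlyApproximableSt p q
  jointly-appʳ⁻¹ h d with h (suc d)
  ... | app _ (t ∷ _) , app _ (pos ∷ _) , app _ (t⋉p ∷ _) , app _ (t⋉q ∷ _) = t , pos , t⋉p , t⋉q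

  jointly⇒ShapeRel : ∀ a b → JointlyApproximable a b → ShapeRel JointlyApproximableSt a b
  jointly⇒ShapeRel a b h with h 0
  ... | _ , _ , var x , var x = var x
  ... | _ , _ , lam _ , lam _ = lam (jointly⇒ShapeRel _ _ (jointly-lam⁻¹ h))
  ... | _ , _ , app _ _ , app _ _ = app (jointly⇒ShapeRel _ _ (jointly-appˡ⁻¹ h)) (jointly-appʳ⁻¹ h)

open JointApproximation using (JointlyApproximableSt; jointly⇒ShapeRel)

jointlyApproximable-isBisimulation : ∀ M N → IsBisimulation M N (JointlyApproximableSt (unfold M) (unfold N))
jointlyApproximable-isBisimulation M N p q = jointly⇒ShapeRel (unfold M) (unfold N) _ _

lemma5p28 : (M N : Tm) → ((d : ℕ) → Σ RTm (λ s → Positive d s × 𝒯 M s × 𝒯 N s)) → M ≈ N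
lemma5p28 M N common-positive-approximants =
  JointlyApproximableSt (unfold M) (unfold N) ,
  jointlyApproximable-isBisimulation M N ,
  common-positive-approximants
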